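{- Let $G$ be a connected simple graph of order $n$ with two non-incident bridges $uv$ and $xy$, and let $G_1,G_2,G_3$ be the three components of $G-\{uv,xy\}$, with $v,y\in V(G_3)$. The following are equivalent. (1) $\sigma^{ - }(G)=2$ and there is a Harary partition $V_1,V_2$ of $V(G)$ with $E(V_1,V_2)=\{uv,xy\}$. (2) All of the following hold: (a) $p(G_1)+p(G_2)=\lceil n/2\rceil$ or $\lfloor n/2\rfloor$; (b) $p(G_1),p(G_2)<\lfloor n/2\rfloor$; (c) for every bridge $e$ of $G$ lying in $G_3$, if $H,K$ are the two components of $G-e$, then $p(H)<\lfloor n/2\rfloor$ or $p(K)<\lfloor n/2\rfloor$.
   Context: For a connected simple graph $G$ of order $p$, a parity labelling is a bijection $f:V(G)\to\{1,\ldots,p\}$; an edge $uv$ is negative if $f(u),f(v)$ have opposite parity. The rna number $\sigma^{ - }(G)$ is the minimum over all such $f$ of the number of negative edges. A Harary partition of $V(G)$ is a partition into two sets $V_1,V_2$ with $\big||V_1|-|V_2|\big|\leq 1$; $E(V_1,V_2)$ denotes the set of edges between $V_1$ and $V_2$. $p(H)$ denotes the order of a graph $H$. -}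

module Defs where

open import Data.Nat using (ℕ; zero; suc; _+_; _*_; _≤_; _<_; _%_; _≡ᵇ_; _<ᵇ_; ⌊_/2⌋; ⌈_/2⌉)
open import Data.Bool using (Bool; true; false; _∧_; not; if_then_else_)
open import Data.Fin using (Fin; toℕ; _≟_)
open import Data.Fin.Subset using (Subset; _∈_; _∉_; ∣_∣)
open import Data.Fin.Permutation using (Permutation′; _⟨$⟩ʳ_)
open import Data.List using (List; map; allFin)
open import Data.Nat.ListAction using (sum)
open import Data.Product using (Σ; _×_; _,_)
open import Data.Sum using (_⊎_)
open import Relation.Binary.PropositionalEquality using (_≡_)
open import Relation.Nullary using (¬_)
open import Relation.Nullary.Decidable using (⌊_⌋)
open import Function.Bundles using (_⇔_)

Adj : ℕ → Set
Adj n = Fin n → Fin n → Bool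

record Graph (n : ℕ) : Set where
  field
    adj    : Adj n
    sym    : ∀ a b → adj a b ≡ adj b a
    irrefl : ∀ a → adj a a ≡ false
open Graph public

SameEdge : ∀ {n} → Fin n → Fin n → Fin n → Fin n → Set
SameEdge a b u v = (a ≡ u × b ≡ v) ⊎ (a ≡ v × b ≡ u)

deleteEdge : ∀ {n} → Adj n → Fin n → Fin n → Adj n
deleteEdge A u v a b =
  A a b ∧ not ((⌊ a ≟ u ⌋ ∧ ⌊ b ≟ v ⌋) Data.Bool.∨ (⌊ a ≟ v ⌋ ∧ ⌊ b ≟ u ⌋))

data Reachable {n : ℕ} (A : Adj n) : Fin n → Fin n → Set where
  here : ∀ {a} → Reachable A a a
  step : ∀ {a b c} → A a b ≡ true → Reachable A b c → Reachable A a c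

Connected : ∀ {n} → Graph n → Set
Connected G = ∀ a b → Reachable (adj G) a b

IsBridge : ∀ {n} → Graph n → Fin n → Fin n → Set
IsBridge G u v = adj G u v ≡ true × ¬ Reachable (deleteEdge (adj G) u v) u v

CompOrder : ∀ {n} → Adj n → Fin n → ℕ → Set
CompOrder {n} A w k =
  Σ (Subset n) λ S → (∀ z → (z ∈ S) ⇔ Reachable A w z) × ∣ S ∣ ≡ k

-- Number of negative edges of G under the labelling a ↦ 1 + toℕ (π a) ∈ {1..n}.
-- Each edge {a,b} is counted once (via toℕ a < toℕ b).
label : ∀ {n} → Permutation′ n → Fin n → ℕ
label π a = suc (toℕ (π ⟨$⟩ʳ a))

negEdges : ∀ {n} → Graph n → Permutation′ n → ℕ
negEdges {n} G π =
  sum (map (λ a → sum (map (λ b →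
    if adj G a b ∧ (toℕ a <ᵇ toℕ b) ∧ not ((label π a % 2) ≡ᵇ (label π b % 2))
    then 1 else 0) (allFin n))) (allFin n))

RnaNumber : ∀ {n} → Graph n → ℕ → Set
RnaNumber {n} G k =
  (Σ (Permutation′ n) λ π → negEdges G π ≡ k) × (∀ (π : Permutation′ n) → k ≤ negEdges G π)

-- Harary partition V₁ = S, V₂ = complement: ||V₁| - |V₂|| ≤ 1.
HararyPartition : ∀ {n} → Subset n → Set
HararyPartition {n} S = ∣ S ∣ * 2 ≤ suc n × n ≤ suc (∣ S ∣ * 2)

Crosses : ∀ {n} → Subset n → Fin n → Fin n → Set
Crosses S a b = (a ∈ S × b ∉ S) ⊎ (a ∉ S × b ∈ S)

CutIs : ∀ {n} → Graph n → Subset n → Fin n → Fin n → Fin n → Fin n → Set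
CutIs G S u v x y =
  (∀ a b → adj G a b ≡ true → Crosses S a b → SameEdge a b u v ⊎ SameEdge a b x y)
  × Crosses S u v × Crosses S x y

-- Recording only the parities of the labels turns σ⁻(G) into the least number of edges cut by a
-- balanced colour class, one of size ⌈n/2⌉ or ⌊n/2⌋: the odd-labelled vertices form such a class,
-- and every balanced class is the odd class of some labelling. In a connected graph a balanced
-- class cut by a single edge ab exists exactly when ab is a bridge with two sides of at least
-- ⌊n/2⌋ vertices, which is what σ⁻(G) = 2 forbids.
--
-- (1) ⇒ (2): the Harary partition is constant on the components G₁, G₂, G₃ of G − {uv, xy}, so
-- its part avoiding v is G₁ ∪ G₂, which gives (a); a component of size ⌊n/2⌋ or a bridge with
-- two large sides would be a balanced class cut once, which gives (b) and (c).
-- (2) ⇒ (1): G₁ ∪ G₂ is balanced and cut exactly by uv and xy. If some balanced class were cut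
-- by a single edge ab, then ab is not inside G₃ by (c), so the components not containing ab are
-- monochromatic and all vertices coloured unlike v lie in G₁ or all in G₂, too few by (b).

module Submission where

open import Defs hiding (sym)
open import Data.Nat
  using (ℕ; zero; suc; _+_; _*_; _≤_; _<_; z≤n; s≤s; s≤s⁻¹; _<ᵇ_; _≡ᵇ_; _%_; ⌊_/2⌋; ⌈_/2⌉)
open import Data.Nat.Properties
  using ( +-0-commutativeMonoid; +-commutativeSemigroup; module ≤-Reasoning
        ; +-comm; +-identityʳ; +-cancelˡ-≡; +-cancelʳ-≤; +-mono-≤; +-monoˡ-≤; +-monoʳ-≤
        ; m≤m+n; m≤n+m; ≤-refl; ≤-reflexive; ≤-trans; ≤-antisym; n≤0⇒n≡0; n≤1+n; suc-injective
        ; m≤n⇒m<n∨m≡n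
        ; <-cmp; <-irrefl; <⇒≯; <⇒≱; ≮⇒≥; _<?_; <ᵇ⇒<; <⇒<ᵇ
        ; ⌊n/2⌋≤⌈n/2⌉; ⌊n/2⌋+⌈n/2⌉≡n; ⌊n/2⌋-mono )
open import Data.Bool using (Bool; true; false; not; _∧_; _∨_; _xor_; if_then_else_)
open import Data.Bool.Properties
  using (¬-not; not-injective; not-involutive; T-≡; xor-annihilates-not; ∧-zeroʳ; ∨-zeroʳ)
import Data.Bool.Properties as Bool
open import Data.Fin using (Fin; zero; suc; toℕ; _≟_; punchIn; punchOut)
open import Data.Fin.Properties using (toℕ-injective; punchInᵢ≢i; punchIn-injective; punchIn-punchOut)
open import Data.Fin.Permutation
  using (Permutation′; _⟨$⟩ʳ_; _∘ₚ_; transpose; lift₀) renaming (id to idₚ)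
open import Data.Product using (Σ; _×_; _,_; proj₁; proj₂; map₂) renaming (map to ×-map; swap to ×-swap)
open import Data.Sum using (_⊎_; inj₁; inj₂; [_,_]′) renaming (map to ⊎-map; swap to ⊎-swap)
open import Data.Fin.Subset using (Subset; _∉_; ∣_∣)
open import Data.Vec using ([]; _∷_; lookup; tabulate)
open import Data.Vec.Properties using ([]=⇒lookup; lookup⇒[]=; lookup∘tabulate)
import Data.List as List
open import Data.List.Properties using (map-tabulate)
import Data.Nat.ListAction as ListAction
open import Data.Empty using (⊥; ⊥-elim)
open import Function using (_∘_; id)
open import Function.Bundles using (Equivalence; _⇔_; mk⇔)
open import Relation.Binary.Definitions using (tri<; tri≈; tri>)
open import Relation.Binary.PropositionalEquality
open import Relation.Nullary using (¬_; contradiction; yes; no; Dec)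
open import Relation.Nullary.Decidable
  using (does; isYes≗does; _×-dec_; _⊎-dec_; dec-true; dec-false; does-⇔; decidable-stable)
open import Algebra.Properties.CommutativeMonoid.Sum +-0-commutativeMonoid
  using (sum; sum-syntax; sum-cong-≗; sum-remove; sum-permute)
open import Algebra.Properties.CommutativeSemigroup +-commutativeSemigroup using (interchange)

xor≡true⇒≢ : ∀ p q → p xor q ≡ true → p ≢ q
xor≡true⇒≢ true  true  () _
xor≡true⇒≢ false false () _
xor≡true⇒≢ true  false _  ()
xor≡true⇒≢ false true  _  ()

≢⇒xor≡true : ∀ p q → p ≢ q → p xor q ≡ true
≢⇒xor≡true true  true  p≢q = contradiction refl p≢q
≢⇒xor≡true true  false _   = refl
≢⇒xor≡true false true  _   = refl
≢⇒xor≡true false false p≢q = contradiction refl p≢q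

bool-ext : ∀ {p q : Bool} → (p ≡ true → q ≡ true) → (q ≡ true → p ≡ true) → p ≡ q
bool-ext {true}  p⇒q _   = sym (p⇒q refl)
bool-ext {false} {true}  _ q⇒p = q⇒p refl
bool-ext {false} {false} _ _   = refl

true-false⇒≢ : ∀ {p q : Bool} → p ≡ true → q ≡ false → p ≢ q
true-false⇒≢ refl refl ()

∨≡true : ∀ {p q} → p ∨ q ≡ true → p ≡ true ⊎ q ≡ true
∨≡true {true}  _ = inj₁ refl
∨≡true {false} q = inj₂ q

-- Counting

indicator : Bool → ℕ
indicator true  = 1
indicator false = 0

count : ∀ {n} → (Fin n → Bool) → ℕ
count {n} P = ∑[ i < n ] indicator (P i)

sum-+ : ∀ {n} (f g : Fin n → ℕ) → sum (λ i → f i + g i) ≡ sum f + sum g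
sum-+ {zero}  f g = refl
sum-+ {suc n} f g =
  trans (cong (f zero + g zero +_) (sum-+ (f ∘ suc) (g ∘ suc))) (interchange (f zero) (g zero) _ _)

sum-mono-≤ : ∀ {n} {f g : Fin n → ℕ} → (∀ i → f i ≤ g i) → sum f ≤ sum g
sum-mono-≤ {zero}  f≤g = z≤n
sum-mono-≤ {suc n} f≤g = +-mono-≤ (f≤g zero) (sum-mono-≤ (f≤g ∘ suc))

≤-sum : ∀ {n} (f : Fin n → ℕ) i → f i ≤ sum f
≤-sum f zero    = m≤m+n _ _
≤-sum f (suc i) = ≤-trans (≤-sum (f ∘ suc) i) (m≤n+m _ _)

sum-zero : ∀ {n} (f : Fin n → ℕ) → (∀ i → f i ≡ 0) → sum f ≡ 0
sum-zero {zero}  f f≡0 = refl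
sum-zero {suc n} f f≡0 = cong₂ _+_ (f≡0 zero) (sum-zero (f ∘ suc) (f≡0 ∘ suc))

sum≡0⇒≡0 : ∀ {n} (f : Fin n → ℕ) → sum f ≡ 0 → ∀ i → f i ≡ 0
sum≡0⇒≡0 f Σ≡0 i = n≤0⇒n≡0 (subst (f i ≤_) Σ≡0 (≤-sum f i))

sum-point : ∀ {n} (f : Fin n → ℕ) i → (∀ j → j ≢ i → f j ≡ 0) → sum f ≡ f i
sum-point {suc n} f i f≡0 = begin
  sum f                               ≡⟨ sum-remove {i = i} f ⟩
  f i + sum (f ∘ punchIn i)           ≡⟨ cong (f i +_) (sum-zero _ λ k → f≡0 _ (punchInᵢ≢i i k)) ⟩
  f i + 0                             ≡⟨ +-identityʳ (f i) ⟩
  f i                                 ∎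
  where open ≡-Reasoning

sum-two-points : ∀ {n} (f : Fin n → ℕ) {i j} → i ≢ j → (∀ k → k ≢ i → k ≢ j → f k ≡ 0) →
                 sum f ≡ f i + f j
sum-two-points {suc n} f {i} {j} i≢j f≡0 = begin
  sum f                      ≡⟨ sum-remove {i = i} f ⟩
  f i + sum (f ∘ punchIn i)  ≡⟨ cong (f i +_) (sum-point (f ∘ punchIn i) (punchOut i≢j) elsewhere) ⟩
  f i + f (punchIn i (punchOut i≢j)) ≡⟨ cong (λ k → f i + f k) (punchIn-punchOut i≢j) ⟩
  f i + f j                  ∎
  where
  open ≡-Reasoning
  elsewhere : ∀ k → k ≢ punchOut i≢j → f (punchIn i k) ≡ 0
  elsewhere k k≢ = f≡0 _ (punchInᵢ≢i i k) λ eq →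
    k≢ (punchIn-injective i k _ (trans eq (sym (punchIn-punchOut i≢j))))

sum≡1⇒point : ∀ {n} (f : Fin n → ℕ) → sum f ≡ 1 →
              Σ (Fin n) λ i → f i ≡ 1 × (∀ j → j ≢ i → f j ≡ 0)
sum≡1⇒point {suc n} f Σ≡1 with f zero in f₀
... | 0 with sum≡1⇒point (f ∘ suc) Σ≡1
...   | i , fi≡1 , rest = suc i , fi≡1 , λ { zero _ → f₀ ; (suc j) j≢i → rest j (j≢i ∘ cong suc) }
sum≡1⇒point {suc n} f Σ≡1 | 1 =
  zero , f₀ , λ { zero 0≢0 → contradiction refl 0≢0
               ; (suc j) _ → sum≡0⇒≡0 (f ∘ suc) (suc-injective Σ≡1) j }
sum≡1⇒point {suc n} f () | suc (suc _)

count-cong : ∀ {n} {P Q : Fin n → Bool} → (∀ i → P i ≡ Q i) → count P ≡ count Q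
count-cong P≗Q = sum-cong-≗ (cong indicator ∘ P≗Q)

count-true : ∀ n → count {n} (λ _ → true) ≡ n
count-true zero    = refl
count-true (suc n) = cong suc (count-true n)

indicator-mono : ∀ p q → (p ≡ true → q ≡ true) → indicator p ≤ indicator q
indicator-mono false q _   = z≤n
indicator-mono true  q p⇒q rewrite p⇒q refl = ≤-refl

indicator-injective : ∀ {p q} → indicator p ≡ indicator q → p ≡ q
indicator-injective {true}  {true}  _ = refl
indicator-injective {false} {false} _ = refl

count-mono : ∀ {n} {P Q : Fin n → Bool} → (∀ i → P i ≡ true → Q i ≡ true) → count P ≤ count Q
count-mono {P = P} {Q} P⊆Q = sum-mono-≤ λ i → indicator-mono (P i) (Q i) (P⊆Q i)

count≤n : ∀ {n} (P : Fin n → Bool) → count P ≤ n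
count≤n {n} P = subst (count P ≤_) (count-true n) (count-mono {P = P} {λ _ → true} λ _ _ → refl)

⊆∧count≡⇒⊇ : ∀ {n} (P Q : Fin n → Bool) → (∀ i → P i ≡ true → Q i ≡ true) →
             count P ≡ count Q → ∀ i → Q i ≡ true → P i ≡ true
⊆∧count≡⇒⊇ {suc n} P Q P⊆Q #P≡#Q i Qi
  with parts (indicator-mono (P zero) (Q zero) (P⊆Q zero)) (count-mono (P⊆Q ∘ suc)) #P≡#Q
  where
  parts : ∀ {a b c d} → a ≤ b → c ≤ d → a + c ≡ b + d → a ≡ b × c ≡ d
  parts {a} {b} {c} {d} a≤b c≤d a+c≡b+d = a≡b , +-cancelˡ-≡ a c d (trans a+c≡b+d (cong (_+ d) (sym a≡b)))
    where
    a≡b : a ≡ b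
    a≡b = ≤-antisym a≤b (+-cancelʳ-≤ c b a (≤-trans (+-monoʳ-≤ b c≤d) (≤-reflexive (sym a+c≡b+d))))
... | heads , tails with i
...   | zero  = trans (indicator-injective heads) Qi
...   | suc j = ⊆∧count≡⇒⊇ (P ∘ suc) (Q ∘ suc) (P⊆Q ∘ suc) tails j Qi

count-∨ : ∀ {n} (P Q : Fin n → Bool) → (∀ i → P i ≡ true → Q i ≡ true → ⊥) →
          count (λ i → P i ∨ Q i) ≡ count P + count Q
count-∨ P Q disjoint =
  trans (sum-cong-≗ λ i → indicator-∨ (P i) (Q i) (disjoint i)) (sum-+ (indicator ∘ P) (indicator ∘ Q))
  where
  indicator-∨ : ∀ p q → (p ≡ true → q ≡ true → ⊥) → indicator (p ∨ q) ≡ indicator p + indicator q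
  indicator-∨ true  true  p∧q = ⊥-elim (p∧q refl refl)
  indicator-∨ true  false _   = refl
  indicator-∨ false q     _   = refl

count-not : ∀ {n} (P : Fin n → Bool) → count P + count (not ∘ P) ≡ n
count-not {n} P = begin
  count P + count (not ∘ P)        ≡⟨ count-∨ P (not ∘ P) (λ i → disjoint (P i)) ⟨
  count (λ i → P i ∨ not (P i))    ≡⟨ count-cong (λ i → ∨-not (P i)) ⟩
  count {n} (λ _ → true)           ≡⟨ count-true n ⟩
  n                                ∎
  where
  open ≡-Reasoning
  disjoint : ∀ p → p ≡ true → not p ≡ true → ⊥
  disjoint true _ ()
  ∨-not : ∀ p → p ∨ not p ≡ true
  ∨-not true  = refl
  ∨-not false = refl

count≡0⇒false : ∀ {n} (P : Fin n → Bool) → count P ≡ 0 → ∀ i → P i ≡ false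
count≡0⇒false P #≡0 i with P i | sum≡0⇒≡0 _ #≡0 i
... | false | _ = refl

count-single : ∀ {n} (P : Fin n → Bool) i → P i ≡ true → (∀ j → P j ≡ true → j ≡ i) →
               count P ≡ 1
count-single P i Pi only = trans (sum-point _ i off) (cong indicator Pi)
  where
  off : ∀ j → j ≢ i → indicator (P j) ≡ 0
  off j j≢i with P j in Pj
  ... | true  = contradiction (only j Pj) j≢i
  ... | false = refl

count≡1⇒single : ∀ {n} (P : Fin n → Bool) → count P ≡ 1 →
                 Σ (Fin n) λ i → P i ≡ true × (∀ j → P j ≡ true → j ≡ i)
count≡1⇒single P #≡1 with sum≡1⇒point _ #≡1
... | i , ind≡1 , rest = i , true-of ind≡1 , only
  where
  true-of : ∀ {p} → indicator p ≡ 1 → p ≡ true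
  true-of {true} _ = refl
  only : ∀ j → P j ≡ true → j ≡ i
  only j Pj with j ≟ i
  ... | yes j≡i = j≡i
  ... | no  j≢i = contradiction (trans (sym (cong indicator Pj)) (rest j j≢i)) λ ()

count≥1⇒witness : ∀ {n} (P : Fin n → Bool) → 1 ≤ count P → Σ (Fin n) λ i → P i ≡ true
count≥1⇒witness {suc n} P 1≤# with P zero in P₀
... | true  = zero , P₀
... | false with count≥1⇒witness (P ∘ suc) 1≤#
...   | i , Pi = suc i , Pi

count-permute : ∀ {n} (P : Fin n → Bool) (π : Permutation′ n) → count (P ∘ (π ⟨$⟩ʳ_)) ≡ count P
count-permute P π = sym (sum-permute (indicator ∘ P) π)

true⇒1≤count : ∀ {n} (P : Fin n → Bool) i → P i ≡ true → 1 ≤ count P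
true⇒1≤count P i Pi = subst (_≤ count P) (cong indicator Pi) (≤-sum (indicator ∘ P) i)

count-not-cong : ∀ {n} {P Q : Fin n → Bool} → count P ≡ count Q → count (not ∘ P) ≡ count (not ∘ Q)
count-not-cong {n} {P} {Q} #P≡#Q = +-cancelˡ-≡ (count Q) _ _ (begin
  count Q + count (not ∘ P)  ≡⟨ cong (_+ count (not ∘ P)) #P≡#Q ⟨
  count P + count (not ∘ P)  ≡⟨ count-not P ⟩
  n                          ≡⟨ count-not Q ⟨
  count Q + count (not ∘ Q)  ∎)
  where open ≡-Reasoning

count-none : ∀ {n} (P : Fin n → Bool) → (∀ i → P i ≢ true) → count P ≡ 0
count-none P ¬P = sum-zero _ λ i → cong indicator (¬-not (¬P i))

count² : ∀ {n} → (Fin n → Fin n → Bool) → ℕ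
count² {n} f = ∑[ a < n ] count (f a)

count²-single : ∀ {n} (f : Fin n → Fin n → Bool) {a b} → f a b ≡ true →
                (∀ c d → f c d ≡ true → c ≡ a × d ≡ b) → count² f ≡ 1
count²-single f {a} {b} fab only =
  trans (sum-point _ a emptyRow) (count-single (f a) b fab λ d fad → proj₂ (only a d fad))
  where
  emptyRow : ∀ c → c ≢ a → count (f c) ≡ 0
  emptyRow c c≢a = count-none (f c) λ d fcd → c≢a (proj₁ (only c d fcd))

count²-pair : ∀ {n} (f : Fin n → Fin n → Bool) {a b c d} → a ≢ c → f a b ≡ true → f c d ≡ true →
              (∀ p q → f p q ≡ true → (p ≡ a × q ≡ b) ⊎ (p ≡ c × q ≡ d)) → count² f ≡ 2
count²-pair f {a} {b} {c} {d} a≢c fab fcd only = begin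
  count² f                  ≡⟨ sum-two-points _ a≢c emptyRow ⟩
  count (f a) + count (f c) ≡⟨ cong₂ _+_ (count-single (f a) b fab rowA) (count-single (f c) d fcd rowC) ⟩
  2                         ∎
  where
  open ≡-Reasoning
  emptyRow : ∀ p → p ≢ a → p ≢ c → count (f p) ≡ 0
  emptyRow p p≢a p≢c = count-none (f p) λ q fpq → [ p≢a ∘ proj₁ , p≢c ∘ proj₁ ]′ (only p q fpq)
  rowA : ∀ q → f a q ≡ true → q ≡ b
  rowA q faq = [ proj₂ , (λ a≡c → contradiction a≡c a≢c) ∘ proj₁ ]′ (only a q faq)
  rowC : ∀ q → f c q ≡ true → q ≡ d
  rowC q fcq = [ (λ c≡a → contradiction (sym c≡a) a≢c) ∘ proj₁ , proj₂ ]′ (only c q fcq)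

count²≡0⇒false : ∀ {n} (f : Fin n → Fin n → Bool) → count² f ≡ 0 → ∀ a b → f a b ≡ false
count²≡0⇒false f #≡0 a = count≡0⇒false (f a) (sum≡0⇒≡0 _ #≡0 a)

count²≡1⇒single : ∀ {n} (f : Fin n → Fin n → Bool) → count² f ≡ 1 →
                  Σ (Fin n) λ a → Σ (Fin n) λ b →
                    f a b ≡ true × (∀ c d → f c d ≡ true → c ≡ a × d ≡ b)
count²≡1⇒single f #≡1 with sum≡1⇒point _ #≡1
... | a , row≡1 , otherRows with count≡1⇒single (f a) row≡1
...   | b , fab , onlyB = a , b , fab , only
  where
  only : ∀ c d → f c d ≡ true → c ≡ a × d ≡ b
  only c d fcd with c ≟ a
  ... | yes refl = refl , onlyB d fcd
  ... | no  c≢a  = contradiction (subst (1 ≤_) (otherRows c c≢a) (true⇒1≤count (f c) d fcd)) λ ()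

-- Rearranging a colouring

equinumerous⇒preimage : ∀ {n} (P Q : Fin n → Bool) → count P ≡ count Q →
                        ∀ i → Σ (Fin n) λ j → Q j ≡ P i
equinumerous⇒preimage P Q #P≡#Q i with P i in Pi
... | true  = count≥1⇒witness Q (subst (1 ≤_) #P≡#Q (true⇒1≤count P i Pi))
... | false with count≥1⇒witness (not ∘ Q)
                   (subst (1 ≤_) (count-not-cong {P = P} {Q} #P≡#Q) (true⇒1≤count (not ∘ P) i (cong not Pi)))
...   | j , ¬Qj = j , not-injective ¬Qj

equinumerous⇒permutation : ∀ {n} (P Q : Fin n → Bool) → count P ≡ count Q →
                           Σ (Permutation′ n) λ π → ∀ a → Q (π ⟨$⟩ʳ a) ≡ P a
equinumerous⇒permutation {zero}  P Q _ = idₚ , λ ()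
-- Move a vertex j with Q j ≡ P zero to the front by a transposition, then recurse on the tails.
equinumerous⇒permutation {suc n} P Q #P≡#Q with equinumerous⇒preimage P Q #P≡#Q zero
... | j , Qj≡P₀ with equinumerous⇒permutation (P ∘ suc) (Q′ ∘ suc) tails
  where
  τ : Permutation′ (suc n)
  τ = transpose zero j
  Q′ : Fin (suc n) → Bool
  Q′ = Q ∘ (τ ⟨$⟩ʳ_)
  tails : count (P ∘ suc) ≡ count (Q′ ∘ suc)
  tails = +-cancelˡ-≡ (indicator (P zero)) _ _ (begin
    count P   ≡⟨ #P≡#Q ⟩
    count Q   ≡⟨ count-permute Q τ ⟨
    count Q′  ≡⟨ cong (λ b → indicator b + count (Q′ ∘ suc)) Qj≡P₀ ⟩
    indicator (P zero) + count (Q′ ∘ suc) ∎)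
    where open ≡-Reasoning
...   | σ , Qσ≡P = lift₀ σ ∘ₚ transpose zero j , λ { zero → Qj≡P₀ ; (suc a) → Qσ≡P a }

-- Balanced sizes

Balanced : ℕ → ℕ → Set
Balanced n k = k ≡ ⌈ n /2⌉ ⊎ k ≡ ⌊ n /2⌋

balanced-suc : ∀ {n k} → Balanced n k → Balanced (suc (suc n)) (suc k)
balanced-suc (inj₁ k≡⌈n/2⌉) = inj₁ (cong suc k≡⌈n/2⌉)
balanced-suc (inj₂ k≡⌊n/2⌋) = inj₂ (cong suc k≡⌊n/2⌋)

harary⇒balanced : ∀ n k → k * 2 ≤ suc n → n ≤ suc (k * 2) → Balanced n k
harary⇒balanced zero          zero    _ _ = inj₂ refl
harary⇒balanced (suc zero)    zero    _ _ = inj₂ refl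
harary⇒balanced (suc zero)    (suc zero) _ _ = inj₁ refl
harary⇒balanced (suc (suc n)) (suc k) (s≤s (s≤s ≤n+1)) (s≤s (s≤s ≤2k+1)) =
  balanced-suc (harary⇒balanced n k ≤n+1 ≤2k+1)
harary⇒balanced zero          (suc k) (s≤s ()) _
harary⇒balanced (suc zero)    (suc (suc k)) (s≤s (s≤s ())) _
harary⇒balanced (suc (suc n)) zero    _ (s≤s ())

balanced⇒harary : ∀ n k → Balanced n k → k * 2 ≤ suc n × n ≤ suc (k * 2)
balanced⇒harary zero          _ (inj₁ refl) = z≤n , z≤n
balanced⇒harary zero          _ (inj₂ refl) = z≤n , z≤n
balanced⇒harary (suc zero)    _ (inj₁ refl) = ≤-refl , s≤s z≤n
balanced⇒harary (suc zero)    _ (inj₂ refl) = z≤n , ≤-refl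
balanced⇒harary (suc (suc n)) _ (inj₁ refl) =
  ×-map (s≤s ∘ s≤s) (s≤s ∘ s≤s) (balanced⇒harary n _ (inj₁ refl))
balanced⇒harary (suc (suc n)) _ (inj₂ refl) =
  ×-map (s≤s ∘ s≤s) (s≤s ∘ s≤s) (balanced⇒harary n _ (inj₂ refl))

balanced⇒⌊n/2⌋≤ : ∀ {n k} → Balanced n k → ⌊ n /2⌋ ≤ k
balanced⇒⌊n/2⌋≤ {n} (inj₁ refl) = ⌊n/2⌋≤⌈n/2⌉ n
balanced⇒⌊n/2⌋≤ {n} (inj₂ refl) = ≤-refl

balanced⇒≤⌈n/2⌉ : ∀ {n k} → Balanced n k → k ≤ ⌈ n /2⌉
balanced⇒≤⌈n/2⌉ {n} (inj₁ refl) = ≤-refl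
balanced⇒≤⌈n/2⌉ {n} (inj₂ refl) = ⌊n/2⌋≤⌈n/2⌉ n

between-halves⇒balanced : ∀ n k → ⌊ n /2⌋ ≤ k → k ≤ ⌈ n /2⌉ → Balanced n k
between-halves⇒balanced zero          zero    _ _ = inj₂ refl
between-halves⇒balanced (suc zero)    zero    _ _ = inj₂ refl
between-halves⇒balanced (suc zero)    (suc zero) _ _ = inj₁ refl
between-halves⇒balanced (suc (suc n)) (suc k) (s≤s ⌊n/2⌋≤k) (s≤s k≤⌈n/2⌉) =
  balanced-suc (between-halves⇒balanced n k ⌊n/2⌋≤k k≤⌈n/2⌉)
between-halves⇒balanced (suc zero)    (suc (suc k)) _ (s≤s ())
between-halves⇒balanced (suc (suc n)) zero    () _

halves⇒balanced : ∀ {n k l} → k + l ≡ n → ⌊ n /2⌋ ≤ k → ⌊ n /2⌋ ≤ l → Balanced n k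
halves⇒balanced {n} {k} {l} k+l≡n ⌊n/2⌋≤k ⌊n/2⌋≤l =
  between-halves⇒balanced n k ⌊n/2⌋≤k (+-cancelʳ-≤ ⌊ n /2⌋ k ⌈ n /2⌉ (begin
    k + ⌊ n /2⌋         ≤⟨ +-monoʳ-≤ k ⌊n/2⌋≤l ⟩
    k + l               ≡⟨ k+l≡n ⟩
    n                   ≡⟨ ⌊n/2⌋+⌈n/2⌉≡n n ⟨
    ⌊ n /2⌋ + ⌈ n /2⌉   ≡⟨ +-comm ⌊ n /2⌋ ⌈ n /2⌉ ⟩
    ⌈ n /2⌉ + ⌊ n /2⌋   ∎))
  where open ≤-Reasoning

balanced-complement : ∀ {n k l} → k + l ≡ n → Balanced n k → Balanced n l
balanced-complement {n} {k} {l} k+l≡n bal =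
  halves⇒balanced (trans (+-comm l k) k+l≡n) ⌊n/2⌋≤l (balanced⇒⌊n/2⌋≤ bal)
  where
  open ≤-Reasoning
  ⌊n/2⌋≤l : ⌊ n /2⌋ ≤ l
  ⌊n/2⌋≤l = +-cancelʳ-≤ ⌈ n /2⌉ ⌊ n /2⌋ l (begin
    ⌊ n /2⌋ + ⌈ n /2⌉  ≡⟨ ⌊n/2⌋+⌈n/2⌉≡n n ⟩
    n                  ≡⟨ k+l≡n ⟨
    k + l              ≤⟨ +-monoˡ-≤ l (balanced⇒≤⌈n/2⌉ bal) ⟩
    ⌈ n /2⌉ + l        ≡⟨ +-comm ⌈ n /2⌉ l ⟩
    l + ⌈ n /2⌉        ∎)

balanced-part : ∀ {n k l} → Balanced n (k + l) → 1 ≤ l → ⌊ n /2⌋ ≤ k → Balanced n k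
balanced-part {n} {k} {l} bal 1≤l ⌊n/2⌋≤k = inj₂ (≤-antisym k≤⌊n/2⌋ ⌊n/2⌋≤k)
  where
  open ≤-Reasoning
  k≤⌊n/2⌋ : k ≤ ⌊ n /2⌋
  k≤⌊n/2⌋ = s≤s⁻¹ (begin
    suc k          ≡⟨ +-comm 1 k ⟩
    k + 1          ≤⟨ +-monoʳ-≤ k 1≤l ⟩
    k + l          ≤⟨ balanced⇒≤⌈n/2⌉ bal ⟩
    ⌈ n /2⌉        ≤⟨ ⌊n/2⌋-mono (n≤1+n (suc n)) ⟩
    suc ⌊ n /2⌋    ∎)

2≤n⇒1≤⌊n/2⌋ : ∀ {n} → 2 ≤ n → 1 ≤ ⌊ n /2⌋
2≤n⇒1≤⌊n/2⌋ (s≤s (s≤s _)) = s≤s z≤n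

distinct⇒2≤n : ∀ {n} {a b : Fin n} → a ≢ b → 2 ≤ n
distinct⇒2≤n {suc zero}    {zero} {zero} a≢b = contradiction refl a≢b
distinct⇒2≤n {suc (suc n)}                a≢b = s≤s (s≤s z≤n)

balanced-xor : ∀ {n} {P : Fin n → Bool} → Balanced n (count P) →
               ∀ c → Balanced n (count (λ z → c xor P z))
balanced-xor         bal false = bal
balanced-xor {P = P} bal true  = balanced-complement (count-not P) bal

balanced⇒bicoloured : ∀ {n} {P : Fin n → Bool} → 2 ≤ n → Balanced n (count P) →
                      Σ (Fin n) λ a → Σ (Fin n) λ b → P a ≢ P b
balanced⇒bicoloured {P = P} 2≤n bal
  with count≥1⇒witness P (1≤ bal) | count≥1⇒witness (not ∘ P) (1≤ (balanced-xor bal true))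
  where
  1≤ : ∀ {k} → Balanced _ k → 1 ≤ k
  1≤ bal′ = ≤-trans (2≤n⇒1≤⌊n/2⌋ 2≤n) (balanced⇒⌊n/2⌋≤ bal′)
... | a , Pa | b , ¬Pb = a , b , λ Pa≡Pb → contradiction (trans (sym ¬Pb) (cong not (trans (sym Pa≡Pb) Pa))) λ ()

-- Cuts

Symmetric : ∀ {n} → Adj n → Set
Symmetric A = ∀ a b → A a b ≡ A b a

CutOnlyBy : ∀ {n} → Adj n → (Fin n → Bool) → Fin n → Fin n → Set
CutOnlyBy A P a b = ∀ c d → A c d ≡ true → P c ≢ P d → SameEdge c d a b

CutOnlyBy₂ : ∀ {n} → Adj n → (Fin n → Bool) → Fin n → Fin n → Fin n → Fin n → Set
CutOnlyBy₂ A P a b a′ b′ =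
  ∀ c d → A c d ≡ true → P c ≢ P d → SameEdge c d a b ⊎ SameEdge c d a′ b′

sameEdge-swap : ∀ {n} {c d a b : Fin n} → SameEdge c d a b → SameEdge c d b a
sameEdge-swap (inj₁ c≡a,d≡b) = inj₂ c≡a,d≡b
sameEdge-swap (inj₂ c≡b,d≡a) = inj₁ c≡b,d≡a

splitPair : ∀ {n} → Adj n → (Fin n → Bool) → Fin n → Fin n → Bool
splitPair A P a b = A a b ∧ (toℕ a <ᵇ toℕ b) ∧ (P a xor P b)

cut : ∀ {n} → Adj n → (Fin n → Bool) → ℕ
cut A P = count² (splitPair A P)

module _ {n} {A : Adj n} {P : Fin n → Bool} where

  splitPair⇒ : ∀ {a b} → splitPair A P a b ≡ true → A a b ≡ true × toℕ a < toℕ b × P a ≢ P b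
  splitPair⇒ {a} {b} split with A a b | toℕ a <ᵇ toℕ b in a<ᵇb | P a xor P b in Pa⊕Pb
  ... | true | true | true = refl , <ᵇ⇒< _ _ (Equivalence.from T-≡ a<ᵇb) , xor≡true⇒≢ _ _ Pa⊕Pb

  splitPair-intro : ∀ {a b} → A a b ≡ true → toℕ a < toℕ b → P a ≢ P b → splitPair A P a b ≡ true
  splitPair-intro {a} {b} Aab a<b Pa≢Pb
    rewrite Aab | Equivalence.to T-≡ (<⇒<ᵇ a<b) | ≢⇒xor≡true (P a) (P b) Pa≢Pb = refl

  splitPair-orient : Symmetric A → ∀ {a b} → A a b ≡ true → P a ≢ P b →
                     splitPair A P a b ≡ true ⊎ splitPair A P b a ≡ true
  splitPair-orient symA {a} {b} Aab Pa≢Pb with <-cmp (toℕ a) (toℕ b)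
  ... | tri< a<b _ _ = inj₁ (splitPair-intro Aab a<b Pa≢Pb)
  ... | tri≈ _ a≡b _ = contradiction (cong P (toℕ-injective a≡b)) Pa≢Pb
  ... | tri> _ _ b<a = inj₂ (splitPair-intro (trans (symA b a) Aab) b<a (Pa≢Pb ∘ sym))

  ordered-sameEdge : ∀ {a b c d} → splitPair A P a b ≡ true → splitPair A P c d ≡ true →
                     SameEdge c d a b → c ≡ a × d ≡ b
  ordered-sameEdge _    _    (inj₁ c≡a,d≡b) = c≡a,d≡b
  ordered-sameEdge ab⁺ ba⁺ (inj₂ (refl , refl)) =
    contradiction (proj₁ (proj₂ (splitPair⇒ ab⁺))) (<⇒≯ (proj₁ (proj₂ (splitPair⇒ ba⁺))))

  cut≡0⇒unsplit : Symmetric A → cut A P ≡ 0 → ∀ {a b} → A a b ≡ true → P a ≢ P b → ⊥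
  cut≡0⇒unsplit symA cut≡0 Aab Pa≢Pb with splitPair-orient symA Aab Pa≢Pb
  ... | inj₁ ab⁺ = contradiction (trans (sym ab⁺) (count²≡0⇒false (splitPair A P) cut≡0 _ _)) λ ()
  ... | inj₂ ba⁺ = contradiction (trans (sym ba⁺) (count²≡0⇒false (splitPair A P) cut≡0 _ _)) λ ()

  cut≡1⇒cutOnlyBy : Symmetric A → cut A P ≡ 1 →
                    Σ (Fin n) λ a → Σ (Fin n) λ b → A a b ≡ true × P a ≢ P b × CutOnlyBy A P a b
  cut≡1⇒cutOnlyBy symA cut≡1 with count²≡1⇒single (splitPair A P) cut≡1
  ... | a , b , ab⁺ , only = a , b , proj₁ (splitPair⇒ ab⁺) , proj₂ (proj₂ (splitPair⇒ ab⁺)) , onlyEdge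
    where
    onlyEdge : CutOnlyBy A P a b
    onlyEdge c d Acd Pc≢Pd with splitPair-orient symA Acd Pc≢Pd
    ... | inj₁ cd⁺ = inj₁ (only c d cd⁺)
    ... | inj₂ dc⁺ = inj₂ (×-swap (only d c dc⁺))

  oriented : Symmetric A → ∀ {a b} → A a b ≡ true → P a ≢ P b →
             Σ (Fin n) λ a′ → Σ (Fin n) λ b′ → splitPair A P a′ b′ ≡ true ×
               (∀ {c d} → SameEdge c d a b → SameEdge c d a′ b′) × (a′ ≡ a ⊎ a′ ≡ b)
  oriented symA {a} {b} Aab Pa≢Pb with splitPair-orient symA Aab Pa≢Pb
  ... | inj₁ ab⁺ = a , b , ab⁺ , id , inj₁ refl
  ... | inj₂ ba⁺ = b , a , ba⁺ , sameEdge-swap , inj₂ refl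

  splitPair-cutOnlyBy : ∀ {a b} → CutOnlyBy A P a b →
                        ∀ c d → splitPair A P c d ≡ true → SameEdge c d a b
  splitPair-cutOnlyBy only c d cd⁺ = only c d (proj₁ (splitPair⇒ cd⁺)) (proj₂ (proj₂ (splitPair⇒ cd⁺)))

  cutOnlyBy⇒cut≡1 : Symmetric A → ∀ {a b} → A a b ≡ true → P a ≢ P b → CutOnlyBy A P a b →
                    cut A P ≡ 1
  cutOnlyBy⇒cut≡1 symA Aab Pa≢Pb only with oriented symA Aab Pa≢Pb
  ... | a′ , b′ , ab⁺ , toOriented , _ =
    count²-single (splitPair A P) ab⁺ λ c d cd⁺ →
      ordered-sameEdge ab⁺ cd⁺ (toOriented (splitPair-cutOnlyBy only c d cd⁺))

  cutOnlyBy₂⇒cut≡2 : Symmetric A → ∀ {a b c d} → a ≢ c → a ≢ d → b ≢ c → b ≢ d →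
                     A a b ≡ true → P a ≢ P b → A c d ≡ true → P c ≢ P d → CutOnlyBy₂ A P a b c d →
                     cut A P ≡ 2
  cutOnlyBy₂⇒cut≡2 symA {a} {b} {c} {d} a≢c a≢d b≢c b≢d Aab Pa≢Pb Acd Pc≢Pd only
    with oriented symA Aab Pa≢Pb | oriented symA Acd Pc≢Pd
  ... | a′ , b′ , ab⁺ , toAB , a′∈ab | c′ , d′ , cd⁺ , toCD , c′∈cd =
    count²-pair (splitPair A P) (distinct a′∈ab c′∈cd) ab⁺ cd⁺ λ p q pq⁺ →
      ⊎-map (ordered-sameEdge ab⁺ pq⁺ ∘ toAB) (ordered-sameEdge cd⁺ pq⁺ ∘ toCD)
        (only p q (proj₁ (splitPair⇒ pq⁺)) (proj₂ (proj₂ (splitPair⇒ pq⁺))))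
    where
    distinct : ∀ {a′ c′} → a′ ≡ a ⊎ a′ ≡ b → c′ ≡ c ⊎ c′ ≡ d → a′ ≢ c′
    distinct (inj₁ refl) (inj₁ refl) = a≢c
    distinct (inj₁ refl) (inj₂ refl) = a≢d
    distinct (inj₂ refl) (inj₁ refl) = b≢c
    distinct (inj₂ refl) (inj₂ refl) = b≢d

cut-cong-xor : ∀ {n} (A : Adj n) (P Q : Fin n → Bool) → (∀ a b → (P a xor P b) ≡ (Q a xor Q b)) →
               cut A P ≡ cut A Q
cut-cong-xor A P Q P≈Q =
  sum-cong-≗ λ a → count-cong λ b → cong (λ s → A a b ∧ (toℕ a <ᵇ toℕ b) ∧ s) (P≈Q a b)

-- Labellings

listSum-allFin : ∀ {n} (f : Fin n → ℕ) → ListAction.sum (List.map f (List.allFin n)) ≡ sum f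
listSum-allFin {n} f = trans (cong ListAction.sum (map-tabulate id f)) (listSum-tabulate f)
  where
  listSum-tabulate : ∀ {m} (g : Fin m → ℕ) → ListAction.sum (List.tabulate g) ≡ sum g
  listSum-tabulate {zero}  g = refl
  listSum-tabulate {suc m} g = cong (g zero +_) (listSum-tabulate (g ∘ suc))

even : ℕ → Bool
even zero          = true
even (suc zero)    = false
even (suc (suc m)) = even m

even-suc : ∀ m → even (suc m) ≡ not (even m)
even-suc zero          = refl
even-suc (suc zero)    = refl
even-suc (suc (suc m)) = even-suc m

suc-%2 : ∀ m → suc m % 2 ≡ indicator (even m)
suc-%2 zero          = refl
suc-%2 (suc zero)    = refl
suc-%2 (suc (suc m)) = suc-%2 m

count-even : ∀ n → count {n} (even ∘ toℕ) ≡ ⌈ n /2⌉ × count {n} (not ∘ even ∘ toℕ) ≡ ⌊ n /2⌋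
count-even zero    = refl , refl
count-even (suc n) =
  cong suc (trans (count-cong {n} {even ∘ suc ∘ toℕ} {not ∘ even ∘ toℕ} (even-suc ∘ toℕ))
                  (proj₂ (count-even n))) ,
  trans (count-cong {n} {not ∘ even ∘ suc ∘ toℕ} {even ∘ toℕ}
                    λ i → trans (cong not (even-suc (toℕ i))) (not-involutive _))
        (proj₁ (count-even n))

-- label π a = 1 + toℕ (π ⟨$⟩ʳ a) is odd iff toℕ (π ⟨$⟩ʳ a) is even.
oddLabelled : ∀ {n} → Permutation′ n → Fin n → Bool
oddLabelled π a = even (toℕ (π ⟨$⟩ʳ a))

negEdges≡cut : ∀ {n} (G : Graph n) π → negEdges G π ≡ cut (adj G) (oddLabelled π)
negEdges≡cut {n} G π =
  trans (listSum-allFin (λ a → ListAction.sum (List.map (term a) (List.allFin n))))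
        (sum-cong-≗ λ a → trans (listSum-allFin (term a)) (sum-cong-≗ (term≡indicator a)))
  where
  term : Fin n → Fin n → ℕ
  term a b = if adj G a b ∧ (toℕ a <ᵇ toℕ b) ∧ not ((label π a % 2) ≡ᵇ (label π b % 2)) then 1 else 0
  if-indicator : ∀ b → (if b then 1 else 0) ≡ indicator b
  if-indicator true  = refl
  if-indicator false = refl
  indicator-≢ᵇ : ∀ p q → not (indicator p ≡ᵇ indicator q) ≡ (p xor q)
  indicator-≢ᵇ true  true  = refl
  indicator-≢ᵇ true  false = refl
  indicator-≢ᵇ false true  = refl
  indicator-≢ᵇ false false = refl
  term≡indicator : ∀ a b → term a b ≡ indicator (splitPair (adj G) (oddLabelled π) a b)
  term≡indicator a b =
    trans (if-indicator _)
          (cong (λ s → indicator (adj G a b ∧ (toℕ a <ᵇ toℕ b) ∧ s))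
                (trans (cong₂ (λ p q → not (p ≡ᵇ q)) (suc-%2 (toℕ (π ⟨$⟩ʳ a)))
                                                      (suc-%2 (toℕ (π ⟨$⟩ʳ b))))
                       (indicator-≢ᵇ (oddLabelled π a) (oddLabelled π b))))

count-oddLabelled : ∀ {n} (π : Permutation′ n) → count (oddLabelled π) ≡ ⌈ n /2⌉
count-oddLabelled {n} π = trans (count-permute (even ∘ toℕ) π) (proj₁ (count-even n))

balanced⇒negEdges≡cut : ∀ {n} (G : Graph n) (P : Fin n → Bool) → Balanced n (count P) →
                        Σ (Permutation′ n) λ π → negEdges G π ≡ cut (adj G) P
balanced⇒negEdges≡cut {n} G P (inj₁ #P≡⌈n/2⌉) = realise P #P≡⌈n/2⌉
  where
  realise : ∀ Q → count Q ≡ ⌈ n /2⌉ → Σ (Permutation′ n) λ π → negEdges G π ≡ cut (adj G) Q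
  realise Q #Q≡⌈n/2⌉
    with equinumerous⇒permutation Q (even ∘ toℕ) (trans #Q≡⌈n/2⌉ (sym (proj₁ (count-even n))))
  ... | π , oddLabelled≗Q = π , trans (negEdges≡cut G π)
    (cut-cong-xor (adj G) (oddLabelled π) Q λ a b → cong₂ _xor_ (oddLabelled≗Q a) (oddLabelled≗Q b))
balanced⇒negEdges≡cut {n} G P (inj₂ #P≡⌊n/2⌋)
  with balanced⇒negEdges≡cut G (not ∘ P) (inj₁ #¬P≡⌈n/2⌉)
  where
  #¬P≡⌈n/2⌉ : count (not ∘ P) ≡ ⌈ n /2⌉
  #¬P≡⌈n/2⌉ = +-cancelˡ-≡ ⌊ n /2⌋ _ _
    (trans (cong (_+ count (not ∘ P)) (sym #P≡⌊n/2⌋)) (trans (count-not P) (sym (⌊n/2⌋+⌈n/2⌉≡n n))))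
... | π , negEdges≡ =
  π , trans negEdges≡ (cut-cong-xor (adj G) (not ∘ P) P λ a b → xor-annihilates-not (P a) (P b))

-- Walks and edge deletion

module _ {n} {B : Adj n} where

  reach-trans : ∀ {a b c} → Reachable B a b → Reachable B b c → Reachable B a c
  reach-trans here         b⇝c = b⇝c
  reach-trans (step e a⇝b) b⇝c = step e (reach-trans a⇝b b⇝c)

  reach-snoc : ∀ {a b c} → Reachable B a b → B b c ≡ true → Reachable B a c
  reach-snoc a⇝b e = reach-trans a⇝b (step e here)

  reach-sym : Symmetric B → ∀ {a b} → Reachable B a b → Reachable B b a
  reach-sym symB here                   = here
  reach-sym symB (step {a} {b} e b⇝c) = reach-snoc (reach-sym symB b⇝c) (trans (symB b a) e)

  reach-mono : ∀ {B′ : Adj n} → (∀ a b → B a b ≡ true → B′ a b ≡ true) →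
               ∀ {a b} → Reachable B a b → Reachable B′ a b
  reach-mono B⊆B′ here       = here
  reach-mono B⊆B′ (step e r) = step (B⊆B′ _ _ e) (reach-mono B⊆B′ r)

  split-on-path : ∀ (P : Fin n → Bool) {s t} → Reachable B s t → P s ≢ P t →
                  Σ (Fin n) λ c → Σ (Fin n) λ d → Reachable B s c × B c d ≡ true × P c ≢ P d
  split-on-path P here Ps≢Pt = contradiction refl Ps≢Pt
  split-on-path P (step {s} {b} e b⇝t) Ps≢Pt with P s Bool.≟ P b
  ... | no  Ps≢Pb = s , b , here , e , Ps≢Pb
  ... | yes Ps≡Pb with split-on-path P b⇝t (Ps≢Pt ∘ trans Ps≡Pb)
  ...   | c , d , b⇝c , Bcd , Pc≢Pd = c , d , step e b⇝c , Bcd , Pc≢Pd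

  reach-constant : ∀ (P : Fin n → Bool) → (∀ {c d} → B c d ≡ true → P c ≡ P d) →
                   ∀ {s t} → Reachable B s t → P s ≡ P t
  reach-constant P constant here         = refl
  reach-constant P constant (step e s⇝t) = trans (constant e) (reach-constant P constant s⇝t)

sameEdge? : ∀ {n} (a b u v : Fin n) → Dec (SameEdge a b u v)
sameEdge? a b u v = ((a ≟ u) ×-dec (b ≟ v)) ⊎-dec ((a ≟ v) ×-dec (b ≟ u))

sameEdge-flip : ∀ {n} {a b u v : Fin n} → SameEdge a b u v → SameEdge b a u v
sameEdge-flip (inj₁ (a≡u , b≡v)) = inj₂ (b≡v , a≡u)
sameEdge-flip (inj₂ (a≡v , b≡u)) = inj₁ (b≡u , a≡v)

module _ {n} {A : Adj n} {u v : Fin n} where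

  deleteEdge-does : ∀ a b → deleteEdge A u v a b ≡ A a b ∧ not (does (sameEdge? a b u v))
  deleteEdge-does a b
    rewrite isYes≗does (a ≟ u) | isYes≗does (b ≟ v) | isYes≗does (a ≟ v) | isYes≗does (b ≟ u) = refl

  deleteEdge-⊆ : ∀ a b → deleteEdge A u v a b ≡ true → A a b ≡ true
  deleteEdge-⊆ a b e with A a b | trans (sym (deleteEdge-does a b)) e
  ... | true  | _  = refl
  ... | false | ()

  deleteEdge-removes : ∀ {a b} → deleteEdge A u v a b ≡ true → ¬ SameEdge a b u v
  deleteEdge-removes {a} {b} e same = contradiction (begin
    true                                    ≡⟨ e ⟨
    deleteEdge A u v a b                    ≡⟨ deleteEdge-does a b ⟩
    A a b ∧ not (does (sameEdge? a b u v))  ≡⟨ cong (λ s → A a b ∧ not s) (dec-true (sameEdge? a b u v) same) ⟩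
    A a b ∧ false                           ≡⟨ ∧-zeroʳ (A a b) ⟩
    false                                   ∎) λ ()
    where open ≡-Reasoning

  deleteEdge-keeps : ∀ {a b} → A a b ≡ true → ¬ SameEdge a b u v → deleteEdge A u v a b ≡ true
  deleteEdge-keeps {a} {b} Aab other
    rewrite deleteEdge-does a b | Aab | dec-false (sameEdge? a b u v) other = refl

  deleteEdge-sym : Symmetric A → Symmetric (deleteEdge A u v)
  deleteEdge-sym symA a b = begin
    deleteEdge A u v a b                        ≡⟨ deleteEdge-does a b ⟩
    A a b ∧ not (does (sameEdge? a b u v))      ≡⟨ cong₂ (λ p s → p ∧ not s) (symA a b) flip-does ⟩
    A b a ∧ not (does (sameEdge? b a u v))      ≡⟨ deleteEdge-does b a ⟨
    deleteEdge A u v b a                        ∎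
    where
    open ≡-Reasoning
    flip-does : does (sameEdge? a b u v) ≡ does (sameEdge? b a u v)
    flip-does = does-⇔ (mk⇔ sameEdge-flip sameEdge-flip) (sameEdge? a b u v) (sameEdge? b a u v)

  reach-deleteEdge : ∀ {s z} → Reachable A s z →
    Reachable (deleteEdge A u v) s z ⊎ Reachable (deleteEdge A u v) u z ⊎ Reachable (deleteEdge A u v) v z
  reach-deleteEdge here = inj₁ here
  reach-deleteEdge (step {s} {b} e b⇝z) with reach-deleteEdge b⇝z
  ... | inj₂ from-u-or-v = inj₂ from-u-or-v
  ... | inj₁ b⇝z′ with sameEdge? s b u v
  ...   | no  other               = inj₁ (step (deleteEdge-keeps e other) b⇝z′)
  ...   | yes (inj₁ (refl , refl)) = inj₂ (inj₂ b⇝z′)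
  ...   | yes (inj₂ (refl , refl)) = inj₂ (inj₁ b⇝z′)

constant⇒cutOnlyBy : ∀ {n} {A : Adj n} {P a b} → (∀ {c d} → deleteEdge A a b c d ≡ true → P c ≡ P d) →
                     CutOnlyBy A P a b
constant⇒cutOnlyBy {A = A} {P} {a} {b} constant c d Acd Pc≢Pd with sameEdge? c d a b
... | yes same  = same
... | no  other = contradiction (constant (deleteEdge-keeps {A = A} Acd other)) Pc≢Pd

cutOnlyBy⇒constant : ∀ {n} {A : Adj n} {P a b} → CutOnlyBy A P a b →
                     ∀ {c d} → deleteEdge A a b c d ≡ true → P c ≡ P d
cutOnlyBy⇒constant {A = A} {P} only {c} {d} Dcd =
  decidable-stable (P c Bool.≟ P d) (deleteEdge-removes {A = A} Dcd ∘ only c d (deleteEdge-⊆ {A = A} c d Dcd))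

constant⇒cutOnlyBy₂ : ∀ {n} {A : Adj n} {P a b a′ b′} →
                      (∀ {c d} → deleteEdge (deleteEdge A a b) a′ b′ c d ≡ true → P c ≡ P d) →
                      CutOnlyBy₂ A P a b a′ b′
constant⇒cutOnlyBy₂ {A = A} {P} {a} {b} {a′} {b′} constant c d Acd Pc≢Pd with sameEdge? c d a b
... | yes same  = inj₁ same
... | no  other =
  inj₂ (constant⇒cutOnlyBy {A = deleteEdge A a b} constant c d (deleteEdge-keeps {A = A} Acd other) Pc≢Pd)

cutOnlyBy₂⇒cutOnlyBy : ∀ {n} {A : Adj n} {P a b a′ b′} → P a′ ≡ P b′ → CutOnlyBy₂ A P a b a′ b′ →
                       CutOnlyBy A P a b
cutOnlyBy₂⇒cutOnlyBy Pa′≡Pb′ only c d Acd Pc≢Pd with only c d Acd Pc≢Pd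
... | inj₁ same                 = same
... | inj₂ (inj₁ (refl , refl)) = contradiction Pa′≡Pb′ Pc≢Pd
... | inj₂ (inj₂ (refl , refl)) = contradiction (sym Pa′≡Pb′) Pc≢Pd

cutOnlyBy₂-swap : ∀ {n} {A : Adj n} {P a b a′ b′} →
                  CutOnlyBy₂ A P a b a′ b′ → CutOnlyBy₂ A P a′ b′ a b
cutOnlyBy₂-swap only c d Acd Pc≢Pd = ⊎-swap (only c d Acd Pc≢Pd)

-- Components

IsComponent : ∀ {n} → Adj n → Fin n → (Fin n → Bool) → Set
IsComponent B w R = ∀ z → R z ≡ true ⇔ Reachable B w z

Closed : ∀ {n} → Adj n → (Fin n → Bool) → Set
Closed B R = ∀ a b → B a b ≡ true → R a ≡ true → R b ≡ true

module _ {n} {B : Adj n} where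

  closed-reach : ∀ {R a z} → Closed B R → R a ≡ true → Reachable B a z → R z ≡ true
  closed-reach closed Ra here         = Ra
  closed-reach closed Ra (step e b⇝z) = closed-reach closed (closed _ _ e Ra) b⇝z

  component-closed : Symmetric B → ∀ {w R} → IsComponent B w R → ∀ {c d} → B c d ≡ true → R c ≡ R d
  component-closed symB comp {c} {d} Bcd = bool-ext
    (λ Rc → Equivalence.from (comp d) (reach-snoc (Equivalence.to (comp c) Rc) Bcd))
    (λ Rd → Equivalence.from (comp c) (reach-snoc (Equivalence.to (comp d) Rd) (trans (symB d c) Bcd)))

  component-outside : ∀ {w R z} → IsComponent B w R → ¬ Reachable B w z → R z ≡ false
  component-outside comp ¬w⇝z = ¬-not (¬w⇝z ∘ Equivalence.to (comp _))

  private
    anyᵇ : ∀ {m} → (Fin m → Bool) → Bool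
    anyᵇ {zero}  f = false
    anyᵇ {suc m} f = f zero ∨ anyᵇ (f ∘ suc)

    anyᵇ-witness : ∀ {m} (f : Fin m → Bool) → anyᵇ f ≡ true → Σ (Fin m) λ i → f i ≡ true
    anyᵇ-witness {suc m} f any≡true with f zero in f₀
    ... | true  = zero , f₀
    ... | false with anyᵇ-witness (f ∘ suc) any≡true
    ...   | i , fi = suc i , fi

    anyᵇ-intro : ∀ {m} (f : Fin m → Bool) i → f i ≡ true → anyᵇ f ≡ true
    anyᵇ-intro f zero    fi rewrite fi = refl
    anyᵇ-intro f (suc i) fi rewrite anyᵇ-intro (f ∘ suc) i fi = ∨-zeroʳ (f zero)

  expand : (Fin n → Bool) → Fin n → Bool
  expand R b = R b ∨ anyᵇ (λ a → R a ∧ B a b)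

  ⊆-expand : ∀ R b → R b ≡ true → expand R b ≡ true
  ⊆-expand R b Rb rewrite Rb = refl

  expand⊆⇒closed : ∀ R → (∀ b → expand R b ≡ true → R b ≡ true) → Closed B R
  expand⊆⇒closed R shrink a b Bab Ra =
    shrink b (trans (cong (R b ∨_) (anyᵇ-intro _ a (cong₂ _∧_ Ra Bab))) (∨-zeroʳ (R b)))

  expand-sound : ∀ R b → expand R b ≡ true → R b ≡ true ⊎ Σ (Fin n) λ a → R a ≡ true × B a b ≡ true
  expand-sound R b Rb⁺ with R b
  ... | true  = inj₁ refl
  ... | false with anyᵇ-witness _ Rb⁺
  ...   | a , RaBab with R a in Ra | B a b in Bab
  ...     | true | true = inj₂ (a , Ra , Bab)

  closed⇒expand⊆ : ∀ R → Closed B R → ∀ b → expand R b ≡ true → R b ≡ true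
  closed⇒expand⊆ R closed b Rb⁺ with expand-sound R b Rb⁺
  ... | inj₁ Rb             = Rb
  ... | inj₂ (a , Ra , Bab) = closed a b Bab Ra

  closed-or-grows : ∀ R → Closed B R ⊎ count R < count (expand R)
  closed-or-grows R with m≤n⇒m<n∨m≡n (count-mono {P = R} {expand R} (⊆-expand R))
  ... | inj₁ grows = inj₂ grows
  ... | inj₂ same  = inj₁ (expand⊆⇒closed R (⊆∧count≡⇒⊇ R (expand R) (⊆-expand R) same))

  expand-preserves-closed : ∀ R → Closed B R → Closed B (expand R)
  expand-preserves-closed R closed a b Bab Ra⁺ =
    ⊆-expand R b (closed a b Bab (closed⇒expand⊆ R closed a Ra⁺))

  reachedWithin : Fin n → ℕ → Fin n → Bool
  reachedWithin w zero    z = does (z ≟ w)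
  reachedWithin w (suc k)   = expand (reachedWithin w k)

  reachedWithin-sound : ∀ w k z → reachedWithin w k z ≡ true → Reachable B w z
  reachedWithin-sound w zero z z≡w with z ≟ w
  ... | yes refl = here
  reachedWithin-sound w (suc k) z reached with expand-sound _ z reached
  ... | inj₁ earlier            = reachedWithin-sound w k z earlier
  ... | inj₂ (a , earlier , Baz) = reach-snoc (reachedWithin-sound w k a earlier) Baz

  reachedWithin-start : ∀ w k → reachedWithin w k w ≡ true
  reachedWithin-start w zero    = dec-true (w ≟ w) refl
  reachedWithin-start w (suc k) = ⊆-expand _ w (reachedWithin-start w k)

  reachedWithin-large-or-closed : ∀ w k → suc k ≤ count (reachedWithin w k) ⊎ Closed B (reachedWithin w k)
  reachedWithin-large-or-closed w zero = inj₁ (true⇒1≤count _ w (reachedWithin-start w zero))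
  reachedWithin-large-or-closed w (suc k) with reachedWithin-large-or-closed w k
  ... | inj₂ closed = inj₂ (expand-preserves-closed _ closed)
  ... | inj₁ large with closed-or-grows (reachedWithin w k)
  ...   | inj₁ closed = inj₂ (expand-preserves-closed _ closed)
  ...   | inj₂ grows  = inj₁ (≤-trans (s≤s large) grows)

  component-exists : ∀ w → Σ (Fin n → Bool) (IsComponent B w)
  component-exists w = reachedWithin w n , λ z →
    mk⇔ (reachedWithin-sound w n z) (closed-reach closed (reachedWithin-start w n))
    where
    closed : Closed B (reachedWithin w n)
    closed with reachedWithin-large-or-closed w n
    ... | inj₂ closed   = closed
    ... | inj₁ too-many = contradiction (≤-trans too-many (count≤n _)) (<-irrefl refl)

∣p∣≡count : ∀ {n} (p : Subset n) → ∣ p ∣ ≡ count (lookup p)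
∣p∣≡count []          = refl
∣p∣≡count (true  ∷ p) = cong suc (∣p∣≡count p)
∣p∣≡count (false ∷ p) = ∣p∣≡count p

∣tabulate∣≡count : ∀ {n} (P : Fin n → Bool) → ∣ tabulate P ∣ ≡ count P
∣tabulate∣≡count P = trans (∣p∣≡count (tabulate P)) (count-cong (lookup∘tabulate P))

∉⇒lookup≡false : ∀ {n} (p : Subset n) z → z ∉ p → lookup p z ≡ false
∉⇒lookup≡false p z z∉p = ¬-not (z∉p ∘ lookup⇒[]= z p)

crosses⇒≢ : ∀ {n} (S : Subset n) {a b} → Crosses S a b → lookup S a ≢ lookup S b
crosses⇒≢ S {b = b} (inj₁ (a∈S , b∉S)) Sa≡Sb =
  contradiction (trans (sym ([]=⇒lookup a∈S)) (trans Sa≡Sb (∉⇒lookup≡false S b b∉S))) λ ()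
crosses⇒≢ S {a} (inj₂ (a∉S , b∈S)) Sa≡Sb =
  contradiction (trans (sym ([]=⇒lookup b∈S)) (trans (sym Sa≡Sb) (∉⇒lookup≡false S a a∉S))) λ ()

≢⇒crosses : ∀ {n} (S : Subset n) {a b} → lookup S a ≢ lookup S b → Crosses S a b
≢⇒crosses S {a} {b} Sa≢Sb with lookup S a in Sa | lookup S b in Sb
... | true  | true  = contradiction refl Sa≢Sb
... | true  | false = inj₁ (lookup⇒[]= a S Sa , λ b∈S → contradiction (trans (sym ([]=⇒lookup b∈S)) Sb) λ ())
... | false | true  = inj₂ ((λ a∈S → contradiction (trans (sym ([]=⇒lookup a∈S)) Sa) λ ()) ,
                           lookup⇒[]= b S Sb)
... | false | false = contradiction refl Sa≢Sb

crosses-tabulate⇒≢ : ∀ {n} (P : Fin n → Bool) {a b} → Crosses (tabulate P) a b → P a ≢ P b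
crosses-tabulate⇒≢ P {a} {b} crosses Pa≡Pb =
  crosses⇒≢ (tabulate P) crosses (trans (lookup∘tabulate P a) (trans Pa≡Pb (sym (lookup∘tabulate P b))))

≢⇒crosses-tabulate : ∀ {n} (P : Fin n → Bool) {a b} → P a ≢ P b → Crosses (tabulate P) a b
≢⇒crosses-tabulate P {a} {b} Pa≢Pb = ≢⇒crosses (tabulate P) λ Sa≡Sb →
  Pa≢Pb (trans (sym (lookup∘tabulate P a)) (trans Sa≡Sb (lookup∘tabulate P b)))

module _ {n} {B : Adj n} {w : Fin n} where

  component⇒compOrder : ∀ {R} → IsComponent B w R → CompOrder B w (count R)
  component⇒compOrder {R} comp =
    tabulate R ,
    (λ z → mk⇔ (Equivalence.to (comp z) ∘ trans (sym (lookup∘tabulate R z)) ∘ []=⇒lookup)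
               (lookup⇒[]= z (tabulate R) ∘ trans (lookup∘tabulate R z) ∘ Equivalence.from (comp z))) ,
    ∣tabulate∣≡count R

  compOrder⇒component : ∀ {k} → CompOrder B w k →
                        Σ (Fin n → Bool) λ R → IsComponent B w R × count R ≡ k
  compOrder⇒component (S , S≡comp , ∣S∣≡k) =
    lookup S ,
    (λ z → mk⇔ (Equivalence.to (S≡comp z) ∘ lookup⇒[]= z S)
               ([]=⇒lookup ∘ Equivalence.from (S≡comp z))) ,
    trans (sym (∣p∣≡count S)) ∣S∣≡k

-- Bridges of a connected graph

module _ {n} (G : Graph n) (connected : Connected G) where

  private
    D : Fin n → Fin n → Adj n
    D = deleteEdge (adj G)

  deleteEdge-sides : ∀ a b z → Reachable (D a b) a z ⊎ Reachable (D a b) b z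
  deleteEdge-sides a b z with reach-deleteEdge (connected a z)
  ... | inj₁ a⇝z         = inj₁ a⇝z
  ... | inj₂ (inj₁ a⇝z) = inj₁ a⇝z
  ... | inj₂ (inj₂ b⇝z) = inj₂ b⇝z

  cut≢0 : ∀ {P a b} → P a ≢ P b → cut (adj G) P ≢ 0
  cut≢0 {P} {a} {b} Pa≢Pb cut≡0 with split-on-path P (connected a b) Pa≢Pb
  ... | c , d , _ , Acd , Pc≢Pd = cut≡0⇒unsplit (Graph.sym G) cut≡0 Acd Pc≢Pd

  cutOnlyBy⇒bridge : ∀ {P a b} → adj G a b ≡ true → P a ≢ P b → CutOnlyBy (adj G) P a b →
                     IsBridge G a b ×
                     IsComponent (D a b) a (λ z → P b xor P z) × IsComponent (D a b) b (λ z → P a xor P z)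
  cutOnlyBy⇒bridge {P} {a} {b} Aab Pa≢Pb only =
    (Aab , Pa≢Pb ∘ keeps) ,
    side Pa≢Pb (deleteEdge-sides a b) ,
    side (Pa≢Pb ∘ sym) (⊎-swap ∘ deleteEdge-sides a b)
    where
    keeps : ∀ {s z} → Reachable (D a b) s z → P s ≡ P z
    keeps = reach-constant P (cutOnlyBy⇒constant only)
    side : ∀ {s t} → P s ≢ P t → (∀ z → Reachable (D a b) s z ⊎ Reachable (D a b) t z) →
           IsComponent (D a b) s (λ z → P t xor P z)
    side Ps≢Pt cover z = mk⇔
      (λ unlike → [ id , (λ t⇝z → contradiction (keeps t⇝z) (xor≡true⇒≢ _ _ unlike)) ]′ (cover z))
      (λ s⇝z → ≢⇒xor≡true _ _ λ Pt≡Pz → Ps≢Pt (trans (keeps s⇝z) (sym Pt≡Pz)))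

  component-cutOnlyBy : ∀ {a b w R} → IsComponent (D a b) w R → CutOnlyBy (adj G) R a b
  component-cutOnlyBy comp = constant⇒cutOnlyBy (component-closed (deleteEdge-sym (Graph.sym G)) comp)

  bridge-sides-count : ∀ {a b H K} → IsBridge G a b → IsComponent (D a b) a H → IsComponent (D a b) b K →
                       count H + count K ≡ n
  bridge-sides-count {a} {b} {H} {K} (_ , ¬a⇝b) compH compK = begin
    count H + count K         ≡⟨ count-∨ H K disjoint ⟨
    count (λ z → H z ∨ K z)   ≡⟨ count-cong covered ⟩
    count {n} (λ _ → true)    ≡⟨ count-true n ⟩
    n                         ∎
    where
    open ≡-Reasoning
    disjoint : ∀ z → H z ≡ true → K z ≡ true → ⊥
    disjoint z Hz Kz = ¬a⇝b (reach-trans (Equivalence.to (compH z) Hz)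
                                         (reach-sym (deleteEdge-sym (Graph.sym G)) (Equivalence.to (compK z) Kz)))
    covered : ∀ z → H z ∨ K z ≡ true
    covered z = [ (λ a⇝z → cong (_∨ K z) (Equivalence.from (compH z) a⇝z)) ,
                  (λ b⇝z → trans (cong (H z ∨_) (Equivalence.from (compK z) b⇝z)) (∨-zeroʳ (H z))) ]′
                (deleteEdge-sides a b z)

  module _ (2≤negEdges : ∀ π → 2 ≤ negEdges G π) where

    ¬balancedSingleCut : ∀ {P a b} → Balanced n (count P) → adj G a b ≡ true → P a ≢ P b →
                         CutOnlyBy (adj G) P a b → ⊥
    ¬balancedSingleCut {P} bal Aab Pa≢Pb only with balanced⇒negEdges≡cut G P bal
    ... | π , negEdges≡cut = contradiction (subst (2 ≤_) negEdges≡1 (2≤negEdges π)) λ { (s≤s ()) }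
      where
      negEdges≡1 : negEdges G π ≡ 1
      negEdges≡1 = trans negEdges≡cut (cutOnlyBy⇒cut≡1 {A = adj G} {P} (Graph.sym G) Aab Pa≢Pb only)

    bridge-small-side : ∀ {a b h k} → IsBridge G a b → CompOrder (D a b) a h → CompOrder (D a b) b k →
                        h < ⌊ n /2⌋ ⊎ k < ⌊ n /2⌋
    bridge-small-side {a} {b} {h} {k} bridge sideA sideB with h <? ⌊ n /2⌋ | k <? ⌊ n /2⌋
    ... | yes h<⌊n/2⌋ | _           = inj₁ h<⌊n/2⌋
    ... | no  _       | yes k<⌊n/2⌋ = inj₂ k<⌊n/2⌋
    ... | no  h≮⌊n/2⌋ | no  k≮⌊n/2⌋ with compOrder⇒component sideA | compOrder⇒component sideB
    ...   | H , compH , #H≡h | K , compK , #K≡k =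
      ⊥-elim (¬balancedSingleCut balanced (proj₁ bridge) Ha≢Hb (component-cutOnlyBy compH))
      where
      balanced : Balanced n (count H)
      balanced = halves⇒balanced (bridge-sides-count bridge compH compK)
                                 (subst (⌊ n /2⌋ ≤_) (sym #H≡h) (≮⇒≥ h≮⌊n/2⌋))
                                 (subst (⌊ n /2⌋ ≤_) (sym #K≡k) (≮⇒≥ k≮⌊n/2⌋))
      Ha≢Hb : H a ≢ H b
      Ha≢Hb Ha≡Hb = contradiction (trans (sym Ha≡Hb) (Equivalence.from (compH a) here))
                                  (λ Hb → proj₂ bridge (Equivalence.to (compH b) Hb))

    small-part : ∀ {R R′ : Fin n → Bool} {p q} → Balanced n (count R + count R′) → 1 ≤ count R′ →
                 adj G p q ≡ true → R p ≢ R q → CutOnlyBy (adj G) R p q → count R < ⌊ n /2⌋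
    small-part {R} bal 1≤#R′ Apq Rp≢Rq only with count R <? ⌊ n /2⌋
    ... | yes small = small
    ... | no  large = ⊥-elim (¬balancedSingleCut (balanced-part bal 1≤#R′ (≮⇒≥ large)) Apq Rp≢Rq only)

-- Two non-incident bridges

module NonIncidentBridges {n} (G : Graph n) (connected : Connected G) {u v x y : Fin n}
  (bridge-uv : IsBridge G u v) (bridge-xy : IsBridge G x y)
  (u≢x : u ≢ x) (u≢y : u ≢ y) (v≢x : v ≢ x) (v≢y : v ≢ y)
  (v⇝y : Reachable (deleteEdge (deleteEdge (adj G) u v) x y) v y) where

  -- B is G − {uv, xy}; its components are G₁ ∋ u, G₂ ∋ x and G₃ ∋ v, y.
  private
    A : Adj n
    A = adj G
    D₁ : Adj n
    D₁ = deleteEdge A u v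
    B : Adj n
    B = deleteEdge D₁ x y

  symA : Symmetric A
  symA = Graph.sym G

  symB : Symmetric B
  symB = deleteEdge-sym (deleteEdge-sym symA)

  B⊆A : ∀ a b → B a b ≡ true → A a b ≡ true
  B⊆A a b = deleteEdge-⊆ {A = A} a b ∘ deleteEdge-⊆ {A = D₁} a b

  B-removes : ∀ {a b} → B a b ≡ true → ¬ SameEdge a b u v × ¬ SameEdge a b x y
  B-removes {a} {b} Bab =
    deleteEdge-removes {A = A} (deleteEdge-⊆ {A = D₁} a b Bab) , deleteEdge-removes {A = D₁} Bab

  ¬u⇝v : ¬ Reachable B u v
  ¬u⇝v = proj₂ bridge-uv ∘ reach-mono (λ a b → deleteEdge-⊆ {A = D₁} a b)

  ¬x⇝y : ¬ Reachable B x y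
  ¬x⇝y = proj₂ bridge-xy ∘ reach-mono λ a b Bab →
    deleteEdge-keeps {A = A} (B⊆A a b Bab) (proj₂ (B-removes Bab))

  ¬u⇝y : ¬ Reachable B u y
  ¬u⇝y u⇝y = ¬u⇝v (reach-trans u⇝y (reach-sym symB v⇝y))

  ¬x⇝v : ¬ Reachable B x v
  ¬x⇝v x⇝v = ¬x⇝y (reach-trans x⇝v v⇝y)

  ¬u⇝x : ¬ Reachable B u x
  ¬u⇝x u⇝x = proj₂ bridge-uv
    (reach-trans (reach-mono (λ a b → deleteEdge-⊆ {A = D₁} a b) u⇝x)
      (step (deleteEdge-keeps {A = A} (proj₁ bridge-xy) xy≠uv)
        (reach-mono (λ a b → deleteEdge-⊆ {A = D₁} a b) (reach-sym symB v⇝y))))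
    where
    xy≠uv : ¬ SameEdge x y u v
    xy≠uv (inj₁ (x≡u , _)) = u≢x (sym x≡u)
    xy≠uv (inj₂ (x≡v , _)) = v≢x (sym x≡v)

  ¬x⇝u : ¬ Reachable B x u
  ¬x⇝u = ¬u⇝x ∘ reach-sym symB

  reach-D₁ : ∀ {s z} → Reachable D₁ s z → Reachable B s z ⊎ Reachable B x z ⊎ Reachable B v z
  reach-D₁ s⇝z with reach-deleteEdge {A = D₁} s⇝z
  ... | inj₁ s⇝z′        = inj₁ s⇝z′
  ... | inj₂ (inj₁ x⇝z) = inj₂ (inj₁ x⇝z)
  ... | inj₂ (inj₂ y⇝z) = inj₂ (inj₂ (reach-trans v⇝y y⇝z))

  covers : ∀ z → Reachable B u z ⊎ Reachable B x z ⊎ Reachable B v z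
  covers z with reach-deleteEdge {A = A} (connected u z)
  ... | inj₁ u⇝z         = reach-D₁ u⇝z
  ... | inj₂ (inj₁ u⇝z) = reach-D₁ u⇝z
  ... | inj₂ (inj₂ v⇝z) = [ inj₂ ∘ inj₂ , inj₂ ]′ (reach-D₁ v⇝z)

  covers′ : ∀ z → Reachable B x z ⊎ Reachable B u z ⊎ Reachable B v z
  covers′ z = [ inj₂ ∘ inj₁ , [ inj₁ , inj₂ ∘ inj₂ ]′ ]′ (covers z)

  components-disjoint : ∀ {R₁ R₂} → IsComponent B u R₁ → IsComponent B x R₂ → ∀ z → R₁ z ≡ true → R₂ z ≡ true → ⊥
  components-disjoint comp₁ comp₂ z R₁z R₂z =
    ¬u⇝x (reach-trans (Equivalence.to (comp₁ z) R₁z) (reach-sym symB (Equivalence.to (comp₂ z) R₂z)))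

  B-constant⇒cutOnlyBy₂ : ∀ {P} → (∀ {c d} → B c d ≡ true → P c ≡ P d) → CutOnlyBy₂ A P u v x y
  B-constant⇒cutOnlyBy₂ = constant⇒cutOnlyBy₂

  component-cutOnlyBy₂ : ∀ {w R} → IsComponent B w R → CutOnlyBy₂ A R u v x y
  component-cutOnlyBy₂ comp = B-constant⇒cutOnlyBy₂ (component-closed symB comp)

  unlike-v⇔G₁∪G₂ : ∀ {P R₁ R₂} → (∀ {c d} → B c d ≡ true → P c ≡ P d) → P u ≢ P v → P x ≢ P y →
                   IsComponent B u R₁ → IsComponent B x R₂ → ∀ z → (P v xor P z) ≡ (R₁ z ∨ R₂ z)
  unlike-v⇔G₁∪G₂ {P} {R₁} {R₂} constant Pu≢Pv Px≢Py comp₁ comp₂ z =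
    bool-ext (λ unlike → [ inG₁ , [ inG₂ , (λ v⇝z → contradiction (along v⇝z) (xor≡true⇒≢ _ _ unlike)) ]′ ]′ (covers z))
             (λ inside → ≢⇒xor≡true _ _ ([ fromG₁ , fromG₂ ]′ (∨≡true inside)))
    where
    along : ∀ {a z} → Reachable B a z → P a ≡ P z
    along = reach-constant P constant
    inG₁ : Reachable B u z → R₁ z ∨ R₂ z ≡ true
    inG₁ u⇝z = cong (_∨ R₂ z) (Equivalence.from (comp₁ z) u⇝z)
    inG₂ : Reachable B x z → R₁ z ∨ R₂ z ≡ true
    inG₂ x⇝z = trans (cong (R₁ z ∨_) (Equivalence.from (comp₂ z) x⇝z)) (∨-zeroʳ (R₁ z))
    fromG₁ : R₁ z ≡ true → P v ≢ P z
    fromG₁ R₁z Pv≡Pz = Pu≢Pv (trans (along (Equivalence.to (comp₁ z) R₁z)) (sym Pv≡Pz))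
    fromG₂ : R₂ z ≡ true → P v ≢ P z
    fromG₂ R₂z Pv≡Pz = Px≢Py (trans (along (Equivalence.to (comp₂ z) R₂z)) (trans (sym Pv≡Pz) (along v⇝y)))

  PartSizes : Set
  PartSizes = ∀ k₁ k₂ → CompOrder B u k₁ → CompOrder B x k₂ → Balanced n (k₁ + k₂) × k₁ < ⌊ n /2⌋ × k₂ < ⌊ n /2⌋

  G₃BridgeSides : Set
  G₃BridgeSides = ∀ a b → IsBridge G a b → Reachable B v a → Reachable B v b →
                  ∀ h k → CompOrder (deleteEdge A a b) a h → CompOrder (deleteEdge A a b) b k →
                  h < ⌊ n /2⌋ ⊎ k < ⌊ n /2⌋

  harary-cut⇒partSizes : (∀ π → 2 ≤ negEdges G π) → Σ (Subset n) (λ S → HararyPartition S × CutIs G S u v x y) →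
                         PartSizes
  harary-cut⇒partSizes 2≤negEdges (S , (lower , upper) , (only , crosses-uv , crosses-xy)) k₁ k₂ size₁ size₂
    with compOrder⇒component size₁ | compOrder⇒component size₂
  ... | R₁ , comp₁ , refl | R₂ , comp₂ , refl =
    balanced ,
    small-part G connected 2≤negEdges balanced (true⇒1≤count R₂ x R₂x) (proj₁ bridge-uv) (true-false⇒≢ R₁u R₁v) only₁ ,
    small-part G connected 2≤negEdges (subst (Balanced n) (+-comm (count R₁) (count R₂)) balanced)
      (true⇒1≤count R₁ u R₁u) (proj₁ bridge-xy) (true-false⇒≢ R₂x R₂y) only₂
    where
    colour : Fin n → Bool
    colour = lookup S
    constant : ∀ {c d} → B c d ≡ true → colour c ≡ colour d
    constant {c} {d} Bcd = decidable-stable (colour c Bool.≟ colour d) λ colours≢ →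
      [ proj₁ (B-removes Bcd) , proj₂ (B-removes Bcd) ]′ (only c d (B⊆A c d Bcd) (≢⇒crosses S colours≢))
    balanced : Balanced n (count R₁ + count R₂)
    balanced =
      subst (Balanced n)
            (trans (count-cong (unlike-v⇔G₁∪G₂ constant (crosses⇒≢ S crosses-uv) (crosses⇒≢ S crosses-xy) comp₁ comp₂))
                   (count-∨ R₁ R₂ (components-disjoint comp₁ comp₂)))
            (balanced-xor (subst (Balanced n) (∣p∣≡count S) (harary⇒balanced n ∣ S ∣ lower upper)) (colour v))
    R₁u : R₁ u ≡ true
    R₁u = Equivalence.from (comp₁ u) here
    R₁v : R₁ v ≡ false
    R₁v = component-outside comp₁ ¬u⇝v
    R₂x : R₂ x ≡ true
    R₂x = Equivalence.from (comp₂ x) here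
    R₂y : R₂ y ≡ false
    R₂y = component-outside comp₂ ¬x⇝y
    only₁ : CutOnlyBy A R₁ u v
    only₁ = cutOnlyBy₂⇒cutOnlyBy (trans (component-outside comp₁ ¬u⇝x) (sym (component-outside comp₁ ¬u⇝y)))
                                 (component-cutOnlyBy₂ comp₁)
    only₂ : CutOnlyBy A R₂ x y
    only₂ = cutOnlyBy₂⇒cutOnlyBy (trans (component-outside comp₂ ¬x⇝u) (sym (component-outside comp₂ ¬x⇝v)))
                                 (cutOnlyBy₂-swap (component-cutOnlyBy₂ comp₂))

  module Converse (partSizes : PartSizes) (g₃BridgeSides : G₃BridgeSides) where

    R₁ : Fin n → Bool
    R₁ = proj₁ (component-exists {B = B} u)
    comp₁ : IsComponent B u R₁
    comp₁ = proj₂ (component-exists {B = B} u)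
    R₂ : Fin n → Bool
    R₂ = proj₁ (component-exists {B = B} x)
    comp₂ : IsComponent B x R₂
    comp₂ = proj₂ (component-exists {B = B} x)

    sizes : Balanced n (count R₁ + count R₂) × count R₁ < ⌊ n /2⌋ × count R₂ < ⌊ n /2⌋
    sizes = partSizes (count R₁) (count R₂) (component⇒compOrder comp₁) (component⇒compOrder comp₂)

    module SingleCut {P : Fin n → Bool} {a b} (balanced : Balanced n (count P))
                     (Aab : A a b ≡ true) (Pa≢Pb : P a ≢ P b) (only : CutOnlyBy A P a b) where

      split-inside : ∀ {t z} → Reachable B t z → P t ≢ P z → Reachable B t a × Reachable B t b
      split-inside t⇝z Pt≢Pz with split-on-path P t⇝z Pt≢Pz
      ... | c , d , t⇝c , Bcd , Pc≢Pd with only c d (B⊆A c d Bcd) Pc≢Pd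
      ...   | inj₁ (refl , refl) = t⇝c , reach-snoc t⇝c Bcd
      ...   | inj₂ (refl , refl) = reach-snoc t⇝c Bcd , t⇝c

      IsEnd : Fin n → Set
      IsEnd w = w ≡ a ⊎ w ≡ b

      reach-end : ∀ {t w} → Reachable B t a × Reachable B t b → IsEnd w → Reachable B t w
      reach-end (t⇝a , _) (inj₁ refl) = t⇝a
      reach-end (_ , t⇝b) (inj₂ refl) = t⇝b

      reach-end-of-same : ∀ {s w p q} → IsEnd w → Reachable B s w → SameEdge p q a b →
                          Reachable B s p ⊎ Reachable B s q
      reach-end-of-same (inj₁ refl) s⇝w (inj₁ (refl , refl)) = inj₁ s⇝w
      reach-end-of-same (inj₁ refl) s⇝w (inj₂ (refl , refl)) = inj₂ s⇝w
      reach-end-of-same (inj₂ refl) s⇝w (inj₁ (refl , refl)) = inj₂ s⇝w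
      reach-end-of-same (inj₂ refl) s⇝w (inj₂ (refl , refl)) = inj₁ s⇝w

      end-unlike-v : Σ (Fin n) λ w → IsEnd w × P v ≢ P w
      end-unlike-v with P a Bool.≟ P v
      ... | yes Pa≡Pv = b , inj₂ refl , λ Pv≡Pb → Pa≢Pb (trans Pa≡Pv Pv≡Pb)
      ... | no  Pa≢Pv = a , inj₁ refl , Pa≢Pv ∘ sym

      monochromatic : ∀ {w p t z} → IsEnd w → Reachable B p w → ¬ Reachable B p t → Reachable B t z →
                      P t ≡ P z
      monochromatic {t = t} {z} end p⇝w ¬p⇝t t⇝z = decidable-stable (P t Bool.≟ P z) λ Pt≢Pz →
        ¬p⇝t (reach-trans p⇝w (reach-sym symB (reach-end (split-inside t⇝z Pt≢Pz) end)))

      trapped : ∀ {w p p′ q′} → IsEnd w → Reachable B p w → ¬ Reachable B p p′ → ¬ Reachable B p q′ →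
                ¬ Reachable B p v → Reachable B v q′ → A p′ q′ ≡ true →
                (∀ z → Reachable B p z ⊎ Reachable B p′ z ⊎ Reachable B v z) →
                ∀ z → P v ≢ P z → Reachable B p z
      trapped {p′ = p′} {q′} end p⇝w ¬p⇝p′ ¬p⇝q′ ¬p⇝v v⇝q′ Ap′q′ cover z Pv≢Pz with cover z
      ... | inj₁ p⇝z         = p⇝z
      ... | inj₂ (inj₂ v⇝z) = contradiction (monochromatic end p⇝w ¬p⇝v v⇝z) Pv≢Pz
      ... | inj₂ (inj₁ p′⇝z) = ⊥-elim ([ ¬p⇝p′ , ¬p⇝q′ ]′ (reach-end-of-same end p⇝w (only p′ q′ Ap′q′ p′q′-split)))
        where
        p′q′-split : P p′ ≢ P q′
        p′q′-split Pp′≡Pq′ = Pv≢Pz (trans (monochromatic end p⇝w ¬p⇝v v⇝q′)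
                                           (trans (sym Pp′≡Pq′) (monochromatic end p⇝w ¬p⇝p′ p′⇝z)))

      ⌊n/2⌋≤unlike : ∀ c → ⌊ n /2⌋ ≤ count (λ z → c xor P z)
      ⌊n/2⌋≤unlike c = balanced⇒⌊n/2⌋≤ (balanced-xor balanced c)

      trapped-small : ∀ {p R} → (∀ z → P v ≢ P z → Reachable B p z) → IsComponent B p R →
                      count R < ⌊ n /2⌋ → ⊥
      trapped-small inside comp small = <⇒≱ small (≤-trans (⌊n/2⌋≤unlike (P v))
        (count-mono λ z unlike → Equivalence.from (comp z) (inside z (xor≡true⇒≢ _ _ unlike))))

      impossible : ⊥
      impossible with end-unlike-v
      ... | w , end , Pv≢Pw with covers w
      ...   | inj₁ u⇝w =
        trapped-small (trapped end u⇝w ¬u⇝x ¬u⇝y ¬u⇝v v⇝y (proj₁ bridge-xy) covers) comp₁ (proj₁ (proj₂ sizes))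
      ...   | inj₂ (inj₁ x⇝w) =
        trapped-small (trapped end x⇝w ¬x⇝u ¬x⇝v ¬x⇝v here (proj₁ bridge-uv) covers′) comp₂ (proj₂ (proj₂ sizes))
      ...   | inj₂ (inj₂ v⇝w) with split-inside v⇝w Pv≢Pw | cutOnlyBy⇒bridge G connected Aab Pa≢Pb only
      ...     | v⇝a , v⇝b | bridge , compA , compB =
        [ (λ small → <⇒≱ small (⌊n/2⌋≤unlike (P b))) , (λ small → <⇒≱ small (⌊n/2⌋≤unlike (P a))) ]′
          (g₃BridgeSides a b bridge v⇝a v⇝b _ _ (component⇒compOrder compA) (component⇒compOrder compB))

    2≤cut : ∀ {P} → Balanced n (count P) → 2 ≤ cut A P
    2≤cut {P} balanced with cut A P in cut≡
    ... | zero with balanced⇒bicoloured (distinct⇒2≤n u≢x) balanced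
    ...   | a , b , Pa≢Pb = ⊥-elim (cut≢0 G connected {P} Pa≢Pb cut≡)
    2≤cut {P} balanced | suc zero with cut≡1⇒cutOnlyBy {A = A} {P} symA cut≡
    ... | a , b , Aab , Pa≢Pb , only = ⊥-elim (SingleCut.impossible balanced Aab Pa≢Pb only)
    2≤cut {P} balanced | suc (suc _) = s≤s (s≤s z≤n)

    G₁∪G₂ : Fin n → Bool
    G₁∪G₂ z = R₁ z ∨ R₂ z

    G₁∪G₂-balanced : Balanced n (count G₁∪G₂)
    G₁∪G₂-balanced = subst (Balanced n) (sym (count-∨ R₁ R₂ (components-disjoint comp₁ comp₂))) (proj₁ sizes)

    G₁∪G₂-cutOnlyBy₂ : CutOnlyBy₂ A G₁∪G₂ u v x y
    G₁∪G₂-cutOnlyBy₂ = B-constant⇒cutOnlyBy₂ λ Bcd →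
      cong₂ _∨_ (component-closed symB comp₁ Bcd) (component-closed symB comp₂ Bcd)

    G₁∪G₂-splits-uv : G₁∪G₂ u ≢ G₁∪G₂ v
    G₁∪G₂-splits-uv = true-false⇒≢ (cong (_∨ R₂ u) (Equivalence.from (comp₁ u) here))
                                  (cong₂ _∨_ (component-outside comp₁ ¬u⇝v) (component-outside comp₂ ¬x⇝v))

    G₁∪G₂-splits-xy : G₁∪G₂ x ≢ G₁∪G₂ y
    G₁∪G₂-splits-xy = true-false⇒≢ (trans (cong (R₁ x ∨_) (Equivalence.from (comp₂ x) here)) (∨-zeroʳ (R₁ x)))
                                  (cong₂ _∨_ (component-outside comp₁ ¬u⇝y) (component-outside comp₂ ¬x⇝y))

    cut-G₁∪G₂≡2 : cut A G₁∪G₂ ≡ 2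
    cut-G₁∪G₂≡2 = cutOnlyBy₂⇒cut≡2 {A = A} {G₁∪G₂} symA u≢x u≢y v≢x v≢y
      (proj₁ bridge-uv) G₁∪G₂-splits-uv (proj₁ bridge-xy) G₁∪G₂-splits-xy G₁∪G₂-cutOnlyBy₂

    rna : RnaNumber G 2
    rna = map₂ (λ negEdges≡cut → trans negEdges≡cut cut-G₁∪G₂≡2) (balanced⇒negEdges≡cut G G₁∪G₂ G₁∪G₂-balanced) ,
          λ π → subst (2 ≤_) (sym (negEdges≡cut G π)) (2≤cut (inj₁ (count-oddLabelled π)))

    harary-cut : Σ (Subset n) λ S → HararyPartition S × CutIs G S u v x y
    harary-cut =
      tabulate G₁∪G₂ ,
      balanced⇒harary n _ (subst (Balanced n) (sym (∣tabulate∣≡count G₁∪G₂)) G₁∪G₂-balanced) ,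
      (λ a b Aab crosses → G₁∪G₂-cutOnlyBy₂ a b Aab (crosses-tabulate⇒≢ G₁∪G₂ crosses)) ,
      ≢⇒crosses-tabulate G₁∪G₂ G₁∪G₂-splits-uv ,
      ≢⇒crosses-tabulate G₁∪G₂ G₁∪G₂-splits-xy

mainTheorem15 : (n : ℕ) (G : Graph n) → Connected G →
    (u v x y : Fin n) → IsBridge G u v → IsBridge G x y →
    u ≢ x → u ≢ y → v ≢ x → v ≢ y →
    Reachable (deleteEdge (deleteEdge (adj G) u v) x y) v y →
    ((RnaNumber G 2 × Σ (Subset n) (λ S → HararyPartition S × CutIs G S u v x y))
    ⇔
    ((∀ k₁ k₂ → CompOrder (deleteEdge (deleteEdge (adj G) u v) x y) u k₁ →
        CompOrder (deleteEdge (deleteEdge (adj G) u v) x y) x k₂ →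
        (k₁ + k₂ ≡ ⌈ n /2⌉ ⊎ k₁ + k₂ ≡ ⌊ n /2⌋) × k₁ < ⌊ n /2⌋ × k₂ < ⌊ n /2⌋)
     × (∀ a b → IsBridge G a b →
        Reachable (deleteEdge (deleteEdge (adj G) u v) x y) v a →
        Reachable (deleteEdge (deleteEdge (adj G) u v) x y) v b →
        ∀ h k → CompOrder (deleteEdge (adj G) a b) a h →
        CompOrder (deleteEdge (adj G) a b) b k →
        h < ⌊ n /2⌋ ⊎ k < ⌊ n /2⌋)))
mainTheorem15 n G connected u v x y bridge-uv bridge-xy u≢x u≢y v≢x v≢y v⇝y = mk⇔
  (λ (rna , harary-cut) →
     harary-cut⇒partSizes (proj₂ rna) harary-cut ,
     λ a b bridge _ _ h k → bridge-small-side G connected (proj₂ rna) bridge)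
  (λ (partSizes , g₃BridgeSides) →
     Converse.rna partSizes g₃BridgeSides , Converse.harary-cut partSizes g₃BridgeSides)
  where open NonIncidentBridges G connected bridge-uv bridge-xy u≢x u≢y v≢x v≢y v⇝y
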